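{- Let $\mathcal{F}=(\mathcal{F}_1,\dots,\mathcal{F}_r)$ be a flag of type $(t_1,\dots,t_r)$ on $\mathbb{F}_q^n$, let $a=\max\{i\mid 2t_i\leq n\}$, $b=\min\{i\mid 2t_i\geq n\}$, and let $\mathbf{H}$ be a subgroup of $\mathrm{GL}(n,q)$ such that $\mathrm{Orb}_{\mathbf{H}}(\mathcal{F}_a)$ and $\mathrm{Orb}_{\mathbf{H}}(\mathcal{F}_b)$ are constant dimension codes of maximum distance. Then (i) $\mathrm{Stab}_{\mathbf{H}}(\mathcal{F}_i)\subseteq\mathrm{Stab}_{\mathbf{H}}(\mathcal{F}_a)$ for all $i\leq a$, and (ii) $\mathrm{Stab}_{\mathbf{H}}(\mathcal{F}_i)\subseteq\mathrm{Stab}_{\mathbf{H}}(\mathcal{F}_b)$ for all $i\geq b$.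
   Context: A flag of type $(t_1,\dots,t_r)$, $0<t_1<\dots<t_r<n$, is a chain $\mathcal{F}_1\subsetneq\cdots\subsetneq\mathcal{F}_r$ of subspaces of $\mathbb{F}_q^n$ with $\dim\mathcal{F}_i=t_i$. $\mathrm{GL}(n,q)$ acts on subspaces by $\mathcal{V}\cdot A=\mathrm{rowsp}(VA)$ where $\mathcal{V}=\mathrm{rowsp}(V)$; for a subgroup $\mathbf{H}$, $\mathrm{Orb}_{\mathbf{H}}(\mathcal{V})=\{\mathcal{V}\cdot A\mid A\in\mathbf{H}\}$ and $\mathrm{Stab}_{\mathbf{H}}(\mathcal{V})=\{A\in\mathbf{H}\mid\mathcal{V}\cdot A=\mathcal{V}\}$. With $d_S(\mathcal{U},\mathcal{V})=\dim(\mathcal{U}+\mathcal{V})-\dim(\mathcal{U}\cap\mathcal{V})$, a set $\mathcal{C}$ of $k$-dimensional subspaces has minimum distance $d_S(\mathcal{C})$ equal to the least distance between distinct members ($0$ if $|\mathcal{C}|=1$) and is of maximum distance if $d_S(\mathcal{C})=2k$ when $2k\leq n$ and $2(n-k)$ when $2k\geq n$. If one of the indices $a,b$ does not exist (its defining set is empty), the statement referring to it is omitted. -}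

module Defs where

open import Level using (Level; 0ℓ)
open import Data.Nat as ℕ using (ℕ; zero; suc; _+_; _∸_; _≤_; _<_)
open import Data.Fin as Fin using (Fin)
open import Data.Vec using (Vec; []; _∷_; replicate; zipWith; map; lookup; _++_)
open import Data.Product using (Σ; ∃; ∃-syntax; _×_; _,_)
open import Data.Sum using (_⊎_)
open import Relation.Binary.PropositionalEquality using (_≡_)
open import Relation.Nullary using (¬_)
open import Algebra.Structures using (IsCommutativeRing)
open import Function.Bundles using (_↔_)

record Field : Set₁ where
  field
    Carrier : Set
    _+ᶠ_ _*ᶠ_ : Carrier → Carrier → Carrier
    -ᶠ_ : Carrier → Carrier
    0ᶠ 1ᶠ : Carrier
    isCommutativeRing : IsCommutativeRing _≡_ _+ᶠ_ _*ᶠ_ -ᶠ_ 0ᶠ 1ᶠ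
    0≢1 : ¬ (0ᶠ ≡ 1ᶠ)
    inverse : (x : Carrier) → ¬ (x ≡ 0ᶠ) → ∃[ y ] (x *ᶠ y ≡ 1ᶠ)

HasOrder : Field → ℕ → Set
HasOrder F q = Fin q ↔ Field.Carrier F

module LinAlg (F : Field) where
  open Field F

  Vector : ℕ → Set
  Vector n = Vec Carrier n

  Matrix : ℕ → ℕ → Set
  Matrix m n = Vec (Vector n) m

  zeroV : ∀ {n} → Vector n
  zeroV = replicate _ 0ᶠ

  _+ᵛ_ : ∀ {n} → Vector n → Vector n → Vector n
  _+ᵛ_ = zipWith _+ᶠ_

  _·ᵛ_ : ∀ {n} → Carrier → Vector n → Vector n
  c ·ᵛ v = map (c *ᶠ_) v

  _⋆_ : ∀ {m n} → Vector m → Matrix m n → Vector n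
  [] ⋆ [] = zeroV
  (c ∷ cs) ⋆ (v ∷ vs) = (c ·ᵛ v) +ᵛ (cs ⋆ vs)

  _⊗_ : ∀ {m k n} → Matrix m k → Matrix k n → Matrix m n
  V ⊗ A = map (_⋆ A) V

  identity : ∀ {n} → Matrix n n
  identity {zero} = []
  identity {suc n} = (1ᶠ ∷ zeroV) ∷ map (0ᶠ ∷_) identity

  Pred : ℕ → Set₁
  Pred n = Vector n → Set

  rowsp : ∀ {m n} → Matrix m n → Pred n
  rowsp V v = ∃[ c ] (c ⋆ V ≡ v)

  _⊆ₛ_ : ∀ {n} → Pred n → Pred n → Set
  U ⊆ₛ W = ∀ v → U v → W v

  _≈ₛ_ : ∀ {n} → Pred n → Pred n → Set
  U ≈ₛ W = (U ⊆ₛ W) × (W ⊆ₛ U)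

  _∩ₛ_ : ∀ {n} → Pred n → Pred n → Pred n
  (U ∩ₛ W) v = U v × W v

  _+ₛ_ : ∀ {n} → Pred n → Pred n → Pred n
  (U +ₛ W) v = ∃[ u ] ∃[ w ] (U u × W w × (u +ᵛ w ≡ v))

  LinIndep : ∀ {t n} → Matrix t n → Set
  LinIndep B = ∀ c → c ⋆ B ≡ zeroV → c ≡ zeroV

  HasDim : ∀ {n} → Pred n → ℕ → Set
  HasDim {n} U t = ∃[ B ] (LinIndep {t} {n} B × (rowsp B ≈ₛ U))

  Subspace : ℕ → Set
  Subspace n = Σ ℕ λ m → Matrix m n

  ⟦_⟧ : ∀ {n} → Subspace n → Pred n
  ⟦ (_ , V) ⟧ = rowsp V

  _·ₛ_ : ∀ {n} → Subspace n → Matrix n n → Subspace n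
  (m , V) ·ₛ A = (m , V ⊗ A)

  DistIs : ∀ {n} → Pred n → Pred n → ℕ → Set
  DistIs U W d = ∃[ s ] ∃[ i ] (HasDim (U +ₛ W) s × HasDim (U ∩ₛ W) i × d ≡ s ∸ i)

  Code : ℕ → Set₁
  Code n = Subspace n → Set

  MinDistIs : ∀ {n} → Code n → ℕ → Set
  MinDistIs C m =
    (∀ U W → C U → C W → ¬ (⟦ U ⟧ ≈ₛ ⟦ W ⟧) → ∀ d → DistIs ⟦ U ⟧ ⟦ W ⟧ d → m ≤ d)
    × ( (∃[ U ] ∃[ W ] (C U × C W × ¬ (⟦ U ⟧ ≈ₛ ⟦ W ⟧) × DistIs ⟦ U ⟧ ⟦ W ⟧ m))
      ⊎ ((∀ U W → C U → C W → ⟦ U ⟧ ≈ₛ ⟦ W ⟧) × m ≡ 0))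

  MaxDistCDC : ∀ {n} → Code n → ℕ → Set
  MaxDistCDC {n} C k =
    (∀ U → C U → HasDim ⟦ U ⟧ k)
    × (2 ℕ.* k ≤ n → MinDistIs C (2 ℕ.* k))
    × (n ≤ 2 ℕ.* k → MinDistIs C (2 ℕ.* (n ∸ k)))

  record IsSubgroupGL (n : ℕ) (H : Matrix n n → Set) : Set where
    field
      has-identity : H identity
      closed-mul : ∀ A B → H A → H B → H (A ⊗ B)
      closed-inv : ∀ A → H A → ∃[ B ] (H B × (A ⊗ B ≡ identity) × (B ⊗ A ≡ identity))

  Orb : ∀ {n} → (Matrix n n → Set) → Subspace n → Code n
  Orb H V W = ∃[ A ] (H A × (⟦ W ⟧ ≈ₛ ⟦ V ·ₛ A ⟧))

  InStab : ∀ {n} → (Matrix n n → Set) → Subspace n → Matrix n n → Set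
  InStab H V A = H A × (⟦ V ·ₛ A ⟧ ≈ₛ ⟦ V ⟧)

  StabSubset : ∀ {n} → (Matrix n n → Set) → Subspace n → Subspace n → Set
  StabSubset H V W = ∀ A → InStab H V A → InStab H W A

  record IsFlag {n r : ℕ} (t : Fin r → ℕ) (𝓕 : Fin r → Subspace n) : Set where
    field
      type-pos : ∀ i → 0 < t i
      type-lt-n : ∀ i → t i < n
      type-incr : ∀ i j → i Fin.< j → t i < t j
      dims : ∀ i → HasDim ⟦ 𝓕 i ⟧ (t i)
      nested : ∀ i j → i Fin.< j → (⟦ 𝓕 i ⟧ ⊆ₛ ⟦ 𝓕 j ⟧) × ¬ (⟦ 𝓕 i ⟧ ≈ₛ ⟦ 𝓕 j ⟧)

  IsIndexA : ∀ {r} → ℕ → (Fin r → ℕ) → Fin r → Set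
  IsIndexA n t a = (2 ℕ.* t a ≤ n) × (∀ i → 2 ℕ.* t i ≤ n → i Fin.≤ a)

  IsIndexB : ∀ {r} → ℕ → (Fin r → ℕ) → Fin r → Set
  IsIndexB n t b = (n ≤ 2 ℕ.* t b) × (∀ i → n ≤ 2 ℕ.* t i → b Fin.≤ i)

{-# OPTIONS --safe #-}
-- Suppose A ∈ H fixes 𝓕ᵢ but moves 𝓕ₐ (i ≤ a). Then 𝓕ₐ and 𝓕ₐ·A are distinct codewords of
-- Orb_H(𝓕ₐ), so their distance is at least 2tₐ; but both contain the nonzero space 𝓕ᵢ = 𝓕ᵢ·A,
-- so dim(𝓕ₐ ∩ 𝓕ₐ·A) ≥ 1 and the distance is below 2tₐ. Dually, for i ≥ b both 𝓕_b and 𝓕_b·A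
-- lie in 𝓕ᵢ ⊊ F^n, so dim(𝓕_b + 𝓕_b·A) < n and the distance is below 2(n − t_b).
-- The dimensions entering these distances are computed from bases built greedily over the
-- finitely many vectors of 𝔽_q^n, and they are well defined because an injection 𝔽_q^k → 𝔽_q^m
-- (coordinates of an independent family in a spanning one) forces q^k ≤ q^m.
module Submission where

open import Defs
open import Data.Nat as ℕ using (ℕ; zero; suc; _+_; _∸_; _*_; _^_; z≤n; s≤s)
import Data.Nat.Properties as ℕP
open import Data.Fin as Fin using (Fin; _≤_)
import Data.Fin.Properties as FinP
open import Data.Vec using ([]; _∷_; map; replicate; _++_; splitAt)
import Data.Vec.Properties as VecP
open import Data.Vec.Recursive using (lift↔; Fin[m^n]↔Fin[m]^n)
open import Data.Vec.Recursive.Properties using (↔Vec)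
open import Data.List as List using (List; allFin)
open import Data.List.Membership.Propositional using (_∈_)
open import Data.List.Relation.Unary.Any using (here; there)
open import Data.List.Membership.Propositional.Properties using (∈-map⁺; ∈-allFin)
open import Data.Product using (∃; ∃-syntax; _×_; _,_; proj₁; proj₂; swap)
open import Data.Sum using (inj₁; inj₂)
open import Data.Vec.Relation.Unary.All as All using (All; []; _∷_)
import Data.Vec.Relation.Unary.All.Properties as All
open import Data.Empty using (⊥-elim)
open import Function using (_∘_)
open import Function.Bundles using (_↔_; Inverse; Injection)
open import Function.Definitions using (Injective)
open import Function.Properties.Inverse using (↔-trans; ↔-sym; ↔⇒↣)
open import Algebra.Structures using (IsCommutativeRing)
open import Relation.Binary.PropositionalEquality
open import Relation.Nullary using (¬_; Dec; yes; no)
open import Relation.Nullary.Decidable using (map′; via-injection; _×-dec_; _→-dec_)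
open import Relation.Unary using (Decidable)

open import Algebra.Properties.CommutativeSemigroup ℕP.+-commutativeSemigroup using (x∙yz≈y∙xz)

+-<-double : ∀ {x y t} → x ℕ.< t → y ℕ.< t → x + y ℕ.< 2 * t
+-<-double {x} {y} {t} x<t y<t = subst (x + y ℕ.<_) (cong (t +_) (sym (ℕP.+-identityʳ t))) (ℕP.+-mono-< x<t y<t)

module VectorAlgebra (F : Field) where
  open Field F
  open LinAlg F
  open IsCommutativeRing isCommutativeRing
    using (+-assoc; +-comm; +-identityˡ; +-identityʳ; -‿inverseʳ; *-assoc;
           *-identityˡ; *-identityʳ; distribˡ; distribʳ; zeroˡ; zeroʳ)
  open ≡-Reasoning

  +ᵛ-identityˡ : ∀ {n} (v : Vector n) → zeroV +ᵛ v ≡ v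
  +ᵛ-identityˡ = VecP.zipWith-identityˡ +-identityˡ

  +ᵛ-identityʳ : ∀ {n} (v : Vector n) → v +ᵛ zeroV ≡ v
  +ᵛ-identityʳ = VecP.zipWith-identityʳ +-identityʳ

  +ᵛ-assoc : ∀ {n} (u v w : Vector n) → (u +ᵛ v) +ᵛ w ≡ u +ᵛ (v +ᵛ w)
  +ᵛ-assoc = VecP.zipWith-assoc +-assoc

  +ᵛ-comm : ∀ {n} (u v : Vector n) → u +ᵛ v ≡ v +ᵛ u
  +ᵛ-comm [] [] = refl
  +ᵛ-comm (x ∷ u) (y ∷ v) = cong₂ _∷_ (+-comm x y) (+ᵛ-comm u v)

  +ᵛ-interchange : ∀ {n} (a b c d : Vector n) → (a +ᵛ b) +ᵛ (c +ᵛ d) ≡ (a +ᵛ c) +ᵛ (b +ᵛ d)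
  +ᵛ-interchange a b c d = begin
    (a +ᵛ b) +ᵛ (c +ᵛ d)   ≡⟨ +ᵛ-assoc a b (c +ᵛ d) ⟩
    a +ᵛ (b +ᵛ (c +ᵛ d))   ≡⟨ cong (a +ᵛ_) (sym (+ᵛ-assoc b c d)) ⟩
    a +ᵛ ((b +ᵛ c) +ᵛ d)   ≡⟨ cong (λ z → a +ᵛ (z +ᵛ d)) (+ᵛ-comm b c) ⟩
    a +ᵛ ((c +ᵛ b) +ᵛ d)   ≡⟨ cong (a +ᵛ_) (+ᵛ-assoc c b d) ⟩
    a +ᵛ (c +ᵛ (b +ᵛ d))   ≡⟨ sym (+ᵛ-assoc a c (b +ᵛ d)) ⟩
    (a +ᵛ c) +ᵛ (b +ᵛ d)   ∎

  ·ᵛ-distribˡ : ∀ {n} c (u v : Vector n) → c ·ᵛ (u +ᵛ v) ≡ (c ·ᵛ u) +ᵛ (c ·ᵛ v)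
  ·ᵛ-distribˡ c [] [] = refl
  ·ᵛ-distribˡ c (x ∷ u) (y ∷ v) = cong₂ _∷_ (distribˡ c x y) (·ᵛ-distribˡ c u v)

  ·ᵛ-distribʳ : ∀ {n} a b (v : Vector n) → (a +ᶠ b) ·ᵛ v ≡ (a ·ᵛ v) +ᵛ (b ·ᵛ v)
  ·ᵛ-distribʳ a b [] = refl
  ·ᵛ-distribʳ a b (x ∷ v) = cong₂ _∷_ (distribʳ x a b) (·ᵛ-distribʳ a b v)

  ·ᵛ-assoc : ∀ {n} a b (v : Vector n) → a ·ᵛ (b ·ᵛ v) ≡ (a *ᶠ b) ·ᵛ v
  ·ᵛ-assoc a b [] = refl
  ·ᵛ-assoc a b (x ∷ v) = cong₂ _∷_ (sym (*-assoc a b x)) (·ᵛ-assoc a b v)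

  ·ᵛ-identityˡ : ∀ {n} (v : Vector n) → 1ᶠ ·ᵛ v ≡ v
  ·ᵛ-identityˡ [] = refl
  ·ᵛ-identityˡ (x ∷ v) = cong₂ _∷_ (*-identityˡ x) (·ᵛ-identityˡ v)

  ·ᵛ-zeroˡ : ∀ {n} (v : Vector n) → 0ᶠ ·ᵛ v ≡ zeroV
  ·ᵛ-zeroˡ [] = refl
  ·ᵛ-zeroˡ (x ∷ v) = cong₂ _∷_ (zeroˡ x) (·ᵛ-zeroˡ v)

  ·ᵛ-zeroʳ : ∀ {n} c → c ·ᵛ zeroV {n} ≡ zeroV
  ·ᵛ-zeroʳ {n} c = trans (VecP.map-replicate (c *ᶠ_) 0ᶠ n) (cong (replicate n) (zeroʳ c))

  zeroV-++ : ∀ a {b} → zeroV {a + b} ≡ zeroV {a} ++ zeroV {b}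
  zeroV-++ zero = refl
  zeroV-++ (suc a) = cong (0ᶠ ∷_) (zeroV-++ a)

  ++-≡zeroV⁻ : ∀ {a b} (c : Vector a) {d : Vector b} → c ++ d ≡ zeroV → c ≡ zeroV × d ≡ zeroV
  ++-≡zeroV⁻ {a} c eq = VecP.++-injective c zeroV (trans eq (zeroV-++ a))

  -- Negation as scaling by -1, so that the linearity lemmas for ⋆ cover it.
  -ᵛ_ : ∀ {n} → Vector n → Vector n
  -ᵛ v = (-ᶠ 1ᶠ) ·ᵛ v

  +ᵛ-inverseʳ : ∀ {n} (v : Vector n) → v +ᵛ (-ᵛ v) ≡ zeroV
  +ᵛ-inverseʳ v = begin
    v +ᵛ (-ᵛ v)                  ≡⟨ cong (_+ᵛ (-ᵛ v)) (sym (·ᵛ-identityˡ v)) ⟩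
    (1ᶠ ·ᵛ v) +ᵛ ((-ᶠ 1ᶠ) ·ᵛ v)  ≡⟨ sym (·ᵛ-distribʳ 1ᶠ (-ᶠ 1ᶠ) v) ⟩
    (1ᶠ +ᶠ (-ᶠ 1ᶠ)) ·ᵛ v         ≡⟨ cong (_·ᵛ v) (-‿inverseʳ 1ᶠ) ⟩
    0ᶠ ·ᵛ v                      ≡⟨ ·ᵛ-zeroˡ v ⟩
    zeroV                        ∎

  +ᵛ≡zeroV⇒≡-ᵛ : ∀ {n} (u v : Vector n) → u +ᵛ v ≡ zeroV → u ≡ -ᵛ v
  +ᵛ≡zeroV⇒≡-ᵛ u v eq = begin
    u                     ≡⟨ sym (+ᵛ-identityʳ u) ⟩
    u +ᵛ zeroV            ≡⟨ cong (u +ᵛ_) (sym (+ᵛ-inverseʳ v)) ⟩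
    u +ᵛ (v +ᵛ (-ᵛ v))    ≡⟨ sym (+ᵛ-assoc u v (-ᵛ v)) ⟩
    (u +ᵛ v) +ᵛ (-ᵛ v)    ≡⟨ cong (_+ᵛ (-ᵛ v)) eq ⟩
    zeroV +ᵛ (-ᵛ v)       ≡⟨ +ᵛ-identityˡ (-ᵛ v) ⟩
    -ᵛ v                  ∎

  -ᵛ-involutive : ∀ {n} (v : Vector n) → -ᵛ (-ᵛ v) ≡ v
  -ᵛ-involutive v = sym (+ᵛ≡zeroV⇒≡-ᵛ v (-ᵛ v) (+ᵛ-inverseʳ v))

  +ᵛ-ᵛ≡zeroV⇒≡ : ∀ {n} (u v : Vector n) → u +ᵛ (-ᵛ v) ≡ zeroV → u ≡ v
  +ᵛ-ᵛ≡zeroV⇒≡ u v eq = trans (+ᵛ≡zeroV⇒≡-ᵛ u (-ᵛ v) eq) (-ᵛ-involutive v)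

  ⋆-zeroˡ : ∀ {m n} (M : Matrix m n) → zeroV ⋆ M ≡ zeroV
  ⋆-zeroˡ [] = refl
  ⋆-zeroˡ (v ∷ M) = trans (cong₂ _+ᵛ_ (·ᵛ-zeroˡ v) (⋆-zeroˡ M)) (+ᵛ-identityˡ zeroV)

  ⋆-distribʳ : ∀ {m n} (c d : Vector m) (M : Matrix m n) → (c +ᵛ d) ⋆ M ≡ (c ⋆ M) +ᵛ (d ⋆ M)
  ⋆-distribʳ [] [] [] = sym (+ᵛ-identityˡ zeroV)
  ⋆-distribʳ (x ∷ c) (y ∷ d) (v ∷ M) = begin
    ((x +ᶠ y) ·ᵛ v) +ᵛ ((c +ᵛ d) ⋆ M)
      ≡⟨ cong₂ _+ᵛ_ (·ᵛ-distribʳ x y v) (⋆-distribʳ c d M) ⟩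
    ((x ·ᵛ v) +ᵛ (y ·ᵛ v)) +ᵛ ((c ⋆ M) +ᵛ (d ⋆ M))
      ≡⟨ +ᵛ-interchange _ _ _ _ ⟩
    ((x ·ᵛ v) +ᵛ (c ⋆ M)) +ᵛ ((y ·ᵛ v) +ᵛ (d ⋆ M))
      ∎

  ⋆-·ᵛ : ∀ {m n} a (c : Vector m) (M : Matrix m n) → (a ·ᵛ c) ⋆ M ≡ a ·ᵛ (c ⋆ M)
  ⋆-·ᵛ a [] [] = sym (·ᵛ-zeroʳ a)
  ⋆-·ᵛ a (x ∷ c) (v ∷ M) = begin
    ((a *ᶠ x) ·ᵛ v) +ᵛ ((a ·ᵛ c) ⋆ M)    ≡⟨ cong₂ _+ᵛ_ (sym (·ᵛ-assoc a x v)) (⋆-·ᵛ a c M) ⟩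
    (a ·ᵛ (x ·ᵛ v)) +ᵛ (a ·ᵛ (c ⋆ M))    ≡⟨ sym (·ᵛ-distribˡ a _ _) ⟩
    a ·ᵛ ((x ·ᵛ v) +ᵛ (c ⋆ M))           ∎

  ⋆-++ : ∀ {a b n} (c : Vector a) (d : Vector b) (A : Matrix a n) (B : Matrix b n) →
         (c ++ d) ⋆ (A ++ B) ≡ (c ⋆ A) +ᵛ (d ⋆ B)
  ⋆-++ [] d [] B = sym (+ᵛ-identityˡ _)
  ⋆-++ (x ∷ c) d (v ∷ A) B = trans (cong ((x ·ᵛ v) +ᵛ_) (⋆-++ c d A B)) (sym (+ᵛ-assoc _ _ _))

  ⋆-⊗ : ∀ {m k n} (c : Vector m) (V : Matrix m k) (A : Matrix k n) → c ⋆ (V ⊗ A) ≡ (c ⋆ V) ⋆ A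
  ⋆-⊗ [] [] A = sym (⋆-zeroˡ A)
  ⋆-⊗ (x ∷ c) (v ∷ V) A = begin
    (x ·ᵛ (v ⋆ A)) +ᵛ (c ⋆ (V ⊗ A))    ≡⟨ cong₂ _+ᵛ_ (sym (⋆-·ᵛ x v A)) (⋆-⊗ c V A) ⟩
    ((x ·ᵛ v) ⋆ A) +ᵛ ((c ⋆ V) ⋆ A)    ≡⟨ sym (⋆-distribʳ (x ·ᵛ v) (c ⋆ V) A) ⟩
    ((x ·ᵛ v) +ᵛ (c ⋆ V)) ⋆ A          ∎

  ⋆-map-0∷ : ∀ {m n} (c : Vector m) (M : Matrix m n) → c ⋆ map (0ᶠ ∷_) M ≡ 0ᶠ ∷ (c ⋆ M)
  ⋆-map-0∷ [] [] = refl
  ⋆-map-0∷ (x ∷ c) (v ∷ M) =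
    trans (cong (_ +ᵛ_) (⋆-map-0∷ c M))
          (cong (_∷ ((x ·ᵛ v) +ᵛ (c ⋆ M))) (trans (+-identityʳ _) (zeroʳ x)))

  ⋆-identity : ∀ {n} (v : Vector n) → v ⋆ identity ≡ v
  ⋆-identity [] = refl
  ⋆-identity (x ∷ v) = begin
    (x ·ᵛ (1ᶠ ∷ zeroV)) +ᵛ (v ⋆ map (0ᶠ ∷_) identity)
      ≡⟨ cong (_ +ᵛ_) (⋆-map-0∷ v identity) ⟩
    (x ·ᵛ (1ᶠ ∷ zeroV)) +ᵛ (0ᶠ ∷ (v ⋆ identity))
      ≡⟨ cong₂ _∷_ (trans (+-identityʳ _) (*-identityʳ x))
                   (trans (cong (_+ᵛ _) (·ᵛ-zeroʳ x)) (+ᵛ-identityˡ _)) ⟩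
    x ∷ (v ⋆ identity)
      ≡⟨ cong (x ∷_) (⋆-identity v) ⟩
    x ∷ v
      ∎

module Enumeration (F : Field) {q : ℕ} (order : HasOrder F q) where
  open Field F
  open LinAlg F

  Fin^↔Vector : ∀ n → Fin (q ^ n) ↔ Vector n
  Fin^↔Vector n = ↔-trans (Fin[m^n]↔Fin[m]^n q n) (↔-trans (lift↔ n order) (↔Vec n))

  _≟ᶠ_ : (x y : Carrier) → Dec (x ≡ y)
  _≟ᶠ_ = via-injection (↔⇒↣ (↔-sym order)) FinP._≟_

  _≟ᵛ_ : ∀ {n} (u v : Vector n) → Dec (u ≡ v)
  _≟ᵛ_ = VecP.≡-dec _≟ᶠ_

  module _ {n} {P : Vector n → Set} (P? : Decidable P) where
    open Inverse (Fin^↔Vector n)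

    ∃-vector? : Dec (∃ P)
    ∃-vector? = map′ (λ (i , p) → to i , p)
                     (λ (v , p) → from v , subst P (sym (strictlyInverseˡ v)) p)
                     (FinP.any? (P? ∘ to))

    ∀-vector? : Dec (∀ v → P v)
    ∀-vector? = map′ (λ all v → subst P (strictlyInverseˡ v) (all (from v)))
                     (λ all i → all (to i))
                     (FinP.all? (P? ∘ to))

  allVectors : ∀ n → List (Vector n)
  allVectors n = List.map (Inverse.to (Fin^↔Vector n)) (allFin (q ^ n))

  ∈-allVectors : ∀ {n} (v : Vector n) → v ∈ allVectors n
  ∈-allVectors {n} v = subst (_∈ allVectors n) (strictlyInverseˡ v) (∈-map⁺ to (∈-allFin (from v)))
    where open Inverse (Fin^↔Vector n)

  1<q : 1 ℕ.< q
  1<q = distinct⇒1< (from 0ᶠ) (from 1ᶠ) (0≢1 ∘ Injection.injective (↔⇒↣ (↔-sym order)))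
    where
      open Inverse order using (from)
      distinct⇒1< : ∀ {p} (i j : Fin p) → i ≢ j → 1 ℕ.< p
      distinct⇒1< {suc zero} Fin.zero Fin.zero i≢j = ⊥-elim (i≢j refl)
      distinct⇒1< {suc (suc _)} _ _ _ = s≤s (s≤s z≤n)

  injective⇒≤ : ∀ {k m} (f : Vector k → Vector m) → Injective _≡_ _≡_ f → k ℕ.≤ m
  injective⇒≤ {k} {m} f f-inj = ℕP.≮⇒≥ λ m<k → ℕP.<⇒≱ (ℕP.^-monoʳ-< q 1<q m<k) q^k≤q^m
    where
      module K = Inverse (Fin^↔Vector k)
      module M = Inverse (Fin^↔Vector m)
      q^k≤q^m : q ^ k ℕ.≤ q ^ m
      q^k≤q^m = FinP.injective⇒≤ {f = M.from ∘ f ∘ K.to}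
        (Injection.injective (↔⇒↣ (Fin^↔Vector k)) ∘ f-inj
          ∘ Injection.injective (↔⇒↣ (↔-sym (Fin^↔Vector m))))

module Subspaces (F : Field) {q : ℕ} (order : HasOrder F q) where
  open Field F
  open LinAlg F
  open VectorAlgebra F
  open Enumeration F order

  record IsSubspace {n} (S : Pred n) : Set where
    field
      zero∈ : S zeroV
      +-closed : ∀ {u w} → S u → S w → S (u +ᵛ w)
      ·-closed : ∀ c {u} → S u → S (c ·ᵛ u)

  open IsSubspace

  rowsp-isSubspace : ∀ {m n} (M : Matrix m n) → IsSubspace (rowsp M)
  rowsp-isSubspace M = record
    { zero∈ = zeroV , ⋆-zeroˡ M
    ; +-closed = λ { (c , refl) (d , refl) → c +ᵛ d , ⋆-distribʳ c d M }
    ; ·-closed = λ { a (c , refl) → a ·ᵛ c , ⋆-·ᵛ a c M }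
    }

  ∩-isSubspace : ∀ {n} {U W : Pred n} → IsSubspace U → IsSubspace W → IsSubspace (U ∩ₛ W)
  ∩-isSubspace SU SW = record
    { zero∈ = zero∈ SU , zero∈ SW
    ; +-closed = λ (u , w) (u′ , w′) → +-closed SU u u′ , +-closed SW w w′
    ; ·-closed = λ c (u , w) → ·-closed SU c u , ·-closed SW c w
    }

  +-isSubspace : ∀ {n} {U W : Pred n} → IsSubspace U → IsSubspace W → IsSubspace (U +ₛ W)
  +-isSubspace SU SW = record
    { zero∈ = zeroV , zeroV , zero∈ SU , zero∈ SW , +ᵛ-identityˡ zeroV
    ; +-closed = λ { (u , w , pu , pw , refl) (u′ , w′ , pu′ , pw′ , refl) →
        u +ᵛ u′ , w +ᵛ w′ , +-closed SU pu pu′ , +-closed SW pw pw′ , +ᵛ-interchange u u′ w w′ }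
    ; ·-closed = λ { c (u , w , pu , pw , refl) →
        c ·ᵛ u , c ·ᵛ w , ·-closed SU c pu , ·-closed SW c pw , sym (·ᵛ-distribˡ c u w) }
    }

  ⊆-+ₛˡ : ∀ {n} {U W : Pred n} → IsSubspace W → U ⊆ₛ (U +ₛ W)
  ⊆-+ₛˡ SW u pu = u , zeroV , pu , zero∈ SW , +ᵛ-identityʳ u

  ⊆-+ₛʳ : ∀ {n} {U W : Pred n} → IsSubspace U → W ⊆ₛ (U +ₛ W)
  ⊆-+ₛʳ SU w pw = zeroV , w , zero∈ SU , pw , +ᵛ-identityˡ w

  rowsp-least : ∀ {m n} {S : Pred n} → IsSubspace S → (M : Matrix m n) → All S M → rowsp M ⊆ₛ S
  rowsp-least SS [] [] _ ([] , refl) = zero∈ SS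
  rowsp-least SS (r ∷ M) (sr ∷ sM) _ (x ∷ c , refl) =
    +-closed SS (·-closed SS x sr) (rowsp-least SS M sM (c ⋆ M) (c , refl))

  rowsp-head : ∀ {m n} (v : Vector n) (M : Matrix m n) → rowsp (v ∷ M) v
  rowsp-head v M = 1ᶠ ∷ zeroV , trans (cong₂ _+ᵛ_ (·ᵛ-identityˡ v) (⋆-zeroˡ M)) (+ᵛ-identityʳ v)

  rowsp-∷⁺ : ∀ {m n} (v : Vector n) (M : Matrix m n) → rowsp M ⊆ₛ rowsp (v ∷ M)
  rowsp-∷⁺ v M w (c , e) = 0ᶠ ∷ c , trans (trans (cong (_+ᵛ (c ⋆ M)) (·ᵛ-zeroˡ v)) (+ᵛ-identityˡ _)) e

  rowsp-rows : ∀ {m n} (M : Matrix m n) → All (rowsp M) M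
  rowsp-rows [] = []
  rowsp-rows (v ∷ M) = rowsp-head v M ∷ All.map (rowsp-∷⁺ v M _) (rowsp-rows M)

  rowsp-⊆ : ∀ {m k n} {M : Matrix m n} (N : Matrix k n) → All (rowsp M) N → rowsp N ⊆ₛ rowsp M
  rowsp-⊆ {M = M} = rowsp-least (rowsp-isSubspace M)

  rowsp-++⁺ˡ : ∀ {a b n} (A : Matrix a n) (B : Matrix b n) → rowsp A ⊆ₛ rowsp (A ++ B)
  rowsp-++⁺ˡ A B = rowsp-⊆ A (proj₁ (All.++⁻ A (rowsp-rows (A ++ B))))

  rowsp-++⁺ʳ : ∀ {a b n} (A : Matrix a n) (B : Matrix b n) → rowsp B ⊆ₛ rowsp (A ++ B)
  rowsp-++⁺ʳ A B = rowsp-⊆ B (proj₂ (All.++⁻ A (rowsp-rows (A ++ B))))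

  rowsp-++-insert : ∀ {a b c n} (A : Matrix a n) (B : Matrix b n) (C : Matrix c n) →
                    rowsp (A ++ C) ⊆ₛ rowsp (A ++ (B ++ C))
  rowsp-++-insert A B C = rowsp-⊆ (A ++ C) (All.++⁺
    (All.map (rowsp-++⁺ˡ A (B ++ C) _) (rowsp-rows A))
    (All.map (rowsp-++⁺ʳ A (B ++ C) _ ∘ rowsp-++⁺ʳ B C _) (rowsp-rows C)))

  rowsp? : ∀ {m n} (M : Matrix m n) → Decidable (rowsp M)
  rowsp? M v = ∃-vector? (λ c → (c ⋆ M) ≟ᵛ v)

  _⊆?_ : ∀ {n} (U W : Subspace n) → Dec (⟦ U ⟧ ⊆ₛ ⟦ W ⟧)
  (_ , VU) ⊆? (_ , VW) = ∀-vector? (λ v → rowsp? VU v →-dec rowsp? VW v)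

  _≈?_ : ∀ {n} (U W : Subspace n) → Dec (⟦ U ⟧ ≈ₛ ⟦ W ⟧)
  U ≈? W = (U ⊆? W) ×-dec (W ⊆? U)

module Dimension (F : Field) {q : ℕ} (order : HasOrder F q) where
  open Field F
  open LinAlg F
  open VectorAlgebra F
  open Enumeration F order
  open Subspaces F order
  open ≡-Reasoning

  independent-[] : ∀ {n} → LinIndep {0} {n} []
  independent-[] [] _ = refl

  -- A vanishing combination with leading coefficient c₀ ≠ 0 would express v as -c₀⁻¹ · (cs ⋆ M).
  independent-∷ : ∀ {m n} {M : Matrix m n} {v : Vector n} →
                  LinIndep M → ¬ rowsp M v → LinIndep (v ∷ M)
  independent-∷ {M = M} {v} ind v∉M (c₀ ∷ cs) eq with c₀ ≟ᶠ 0ᶠ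
  ... | yes refl = cong (0ᶠ ∷_) (ind cs (begin
    cs ⋆ M                    ≡⟨ sym (+ᵛ-identityˡ _) ⟩
    zeroV +ᵛ (cs ⋆ M)         ≡⟨ cong (_+ᵛ (cs ⋆ M)) (sym (·ᵛ-zeroˡ v)) ⟩
    (0ᶠ ·ᵛ v) +ᵛ (cs ⋆ M)     ≡⟨ eq ⟩
    zeroV                     ∎))
  ... | no c₀≢0 with inverse c₀ c₀≢0
  ... | c₀⁻¹ , c₀c₀⁻¹≡1 = ⊥-elim (v∉M ((c₀⁻¹ *ᶠ (-ᶠ 1ᶠ)) ·ᵛ cs , (begin
    ((c₀⁻¹ *ᶠ (-ᶠ 1ᶠ)) ·ᵛ cs) ⋆ M   ≡⟨ ⋆-·ᵛ _ cs M ⟩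
    (c₀⁻¹ *ᶠ (-ᶠ 1ᶠ)) ·ᵛ (cs ⋆ M)   ≡⟨ sym (·ᵛ-assoc c₀⁻¹ (-ᶠ 1ᶠ) _) ⟩
    c₀⁻¹ ·ᵛ (-ᵛ (cs ⋆ M))           ≡⟨ cong (c₀⁻¹ ·ᵛ_) (sym (+ᵛ≡zeroV⇒≡-ᵛ _ _ eq)) ⟩
    c₀⁻¹ ·ᵛ (c₀ ·ᵛ v)               ≡⟨ ·ᵛ-assoc c₀⁻¹ c₀ v ⟩
    (c₀⁻¹ *ᶠ c₀) ·ᵛ v               ≡⟨ cong (_·ᵛ v) (trans (*-comm c₀⁻¹ c₀) c₀c₀⁻¹≡1) ⟩
    1ᶠ ·ᵛ v                         ≡⟨ ·ᵛ-identityˡ v ⟩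
    v                               ∎)))
    where open IsCommutativeRing isCommutativeRing using (*-comm)

  independent⇒≤ : ∀ {k m n} {B : Matrix k n} {C : Matrix m n} →
                  LinIndep B → rowsp B ⊆ₛ rowsp C → k ℕ.≤ m
  independent⇒≤ {B = B} {C} ind B⊆C = injective⇒≤ coords coords-injective
    where
      coords : _ → _
      coords c = proj₁ (B⊆C (c ⋆ B) (c , refl))

      coords-spec : ∀ c → coords c ⋆ C ≡ c ⋆ B
      coords-spec c = proj₂ (B⊆C (c ⋆ B) (c , refl))

      coords-injective : Injective _≡_ _≡_ coords
      coords-injective {u} {v} e = +ᵛ-ᵛ≡zeroV⇒≡ u v (ind _ (begin
        (u +ᵛ (-ᵛ v)) ⋆ B          ≡⟨ ⋆-distribʳ u (-ᵛ v) B ⟩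
        (u ⋆ B) +ᵛ ((-ᵛ v) ⋆ B)    ≡⟨ cong ((u ⋆ B) +ᵛ_) (⋆-·ᵛ _ v B) ⟩
        (u ⋆ B) +ᵛ (-ᵛ (v ⋆ B))    ≡⟨ cong (_+ᵛ (-ᵛ (v ⋆ B))) uB≡vB ⟩
        (v ⋆ B) +ᵛ (-ᵛ (v ⋆ B))    ≡⟨ +ᵛ-inverseʳ _ ⟩
        zeroV                      ∎))
        where
          uB≡vB : u ⋆ B ≡ v ⋆ B
          uB≡vB = trans (sym (coords-spec u)) (trans (cong (_⋆ C) e) (coords-spec v))

  dim-mono : ∀ {n a b} {S T : Pred n} → HasDim S a → HasDim T b → S ⊆ₛ T → a ℕ.≤ b
  dim-mono (_ , indS , BS⊆S , _) (_ , _ , _ , T⊆BT) S⊆T =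
    independent⇒≤ indS (λ v → T⊆BT v ∘ S⊆T v ∘ BS⊆S v)

  dim-unique : ∀ {n a b} {S : Pred n} → HasDim S a → HasDim S b → a ≡ b
  dim-unique dimS dimS′ = ℕP.≤-antisym (dim-mono dimS dimS′ (λ _ p → p)) (dim-mono dimS′ dimS (λ _ p → p))

  dim-pos : ∀ {n t v} {S : Pred n} → HasDim S t → S v → v ≢ zeroV → 0 ℕ.< t
  dim-pos {t = zero} ([] , _ , _ , S⊆[]) v∈S v≢0 with S⊆[] _ v∈S
  ... | [] , e = ⊥-elim (v≢0 (sym e))
  dim-pos {t = suc _} _ _ _ = s≤s z≤n

  nonzero-∈ : ∀ {n t} {S : Pred n} → 0 ℕ.< t → HasDim S t → ∃[ v ] (S v × v ≢ zeroV)
  nonzero-∈ {t = suc _} _ (v ∷ B , ind , B⊆S , _) =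
    v , B⊆S v (rowsp-head v B) ,
    λ v≡0 → 0≢1 (sym (VecP.∷-injectiveˡ (ind (1ᶠ ∷ zeroV) (trans (proj₂ (rowsp-head v B)) v≡0))))

  record Extension {k n} (S : Pred n) (L : Matrix k n) : Set where
    field
      {size} : ℕ
      rows : Matrix size n
      independent : LinIndep (rows ++ L)
      inside : All S rows
      spans : S ⊆ₛ rowsp (rows ++ L)

  module _ {k n} {S : Pred n} (S? : Decidable S) (L : Matrix k n) where

    private
      record Greedy {a} (acc : Matrix a n) (vs : List (Vector n)) : Set where
        field
          {size} : ℕ
          rows : Matrix size n
          independent : LinIndep (rows ++ L)
          inside : All S rows
          keeps : rowsp (acc ++ L) ⊆ₛ rowsp (rows ++ L)
          covers : ∀ {w} → w ∈ vs → S w → rowsp (rows ++ L) w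

      open Greedy

      skip : ∀ {a} {acc : Matrix a n} {v vs} →
             (S v → rowsp (acc ++ L) v) → Greedy acc vs → Greedy acc (v List.∷ vs)
      skip v∈ r = record
        { rows = rows r ; independent = independent r ; inside = inside r ; keeps = keeps r
        ; covers = λ { (here refl) sv → keeps r _ (v∈ sv) ; (there w∈) → covers r w∈ }
        }

      take : ∀ {a} {acc : Matrix a n} {v vs} → Greedy (v ∷ acc) vs → Greedy acc (v List.∷ vs)
      take {acc = acc} {v} r = record
        { rows = rows r ; independent = independent r ; inside = inside r
        ; keeps = λ w → keeps r w ∘ rowsp-∷⁺ v (acc ++ L) w
        ; covers = λ { (here refl) _ → keeps r v (rowsp-head v (acc ++ L)) ; (there w∈) → covers r w∈ }
        }

      greedy : ∀ {a} (acc : Matrix a n) vs → LinIndep (acc ++ L) → All S acc → Greedy acc vs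
      greedy acc List.[] ind accS =
        record { rows = acc ; independent = ind ; inside = accS ; keeps = λ _ p → p ; covers = λ () }
      greedy acc (v List.∷ vs) ind accS with S? v | rowsp? (acc ++ L) v
      ... | yes sv | no v∉ = take (greedy (v ∷ acc) vs (independent-∷ ind v∉) (sv ∷ accS))
      ... | yes _ | yes v∈ = skip (λ _ → v∈) (greedy acc vs ind accS)
      ... | no ¬sv | _ = skip (⊥-elim ∘ ¬sv) (greedy acc vs ind accS)

    extend-basis : LinIndep L → Extension S L
    extend-basis ind = record
      { rows = rows r ; independent = independent r ; inside = inside r
      ; spans = λ w → covers r (∈-allVectors w) }
      where r = greedy [] (allVectors n) ind []

  -- If p ∈ ⟨X⟩ and r ∈ ⟨Y ++ K⟩ cancel, then p = -r lies in the intersection, hence in ⟨K⟩.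
  independent-++-++ : ∀ {a b c n} {X : Matrix a n} {Y : Matrix b n} {K : Matrix c n} →
    LinIndep (X ++ K) → LinIndep (Y ++ K) → (rowsp (X ++ K) ∩ₛ rowsp (Y ++ K)) ⊆ₛ rowsp K →
    LinIndep (X ++ (Y ++ K))
  independent-++-++ {a} {X = X} {Y} {K} indXK indYK meet c eq with splitAt a c
  ... | cx , cr , refl = trans (cong₂ _++_ cx≡0 cr≡0) (sym (zeroV-++ a))
    where
      p = cx ⋆ X
      r = cr ⋆ (Y ++ K)

      p+r≡0 : p +ᵛ r ≡ zeroV
      p+r≡0 = trans (sym (⋆-++ cx cr X (Y ++ K))) eq

      p∈K : rowsp K p
      p∈K = meet p ( rowsp-++⁺ˡ X K p (cx , refl)
                   , (-ᵛ cr , trans (⋆-·ᵛ _ cr (Y ++ K)) (sym (+ᵛ≡zeroV⇒≡-ᵛ p r p+r≡0))))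

      d = proj₁ p∈K

      cx≡0 : cx ≡ zeroV
      cx≡0 = proj₁ (++-≡zeroV⁻ cx (indXK (cx ++ (-ᵛ d)) (begin
        (cx ++ (-ᵛ d)) ⋆ (X ++ K)   ≡⟨ ⋆-++ cx (-ᵛ d) X K ⟩
        p +ᵛ ((-ᵛ d) ⋆ K)           ≡⟨ cong (p +ᵛ_) (⋆-·ᵛ _ d K) ⟩
        p +ᵛ (-ᵛ (d ⋆ K))           ≡⟨ cong (λ z → p +ᵛ (-ᵛ z)) (proj₂ p∈K) ⟩
        p +ᵛ (-ᵛ p)                 ≡⟨ +ᵛ-inverseʳ p ⟩
        zeroV                       ∎)))

      cr≡0 : cr ≡ zeroV
      cr≡0 = indYK cr (begin
        r             ≡⟨ sym (+ᵛ-identityˡ r) ⟩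
        zeroV +ᵛ r    ≡⟨ cong (_+ᵛ r) (sym (trans (cong (_⋆ X) cx≡0) (⋆-zeroˡ X))) ⟩
        p +ᵛ r        ≡⟨ p+r≡0 ⟩
        zeroV         ∎)

  record DimensionFormula {n} (U W : Pred n) : Set where
    field
      ex ey k : ℕ
      dimˡ : HasDim U (ex + k)
      dimʳ : HasDim W (ey + k)
      dim∩ : HasDim (U ∩ₛ W) k
      dim+ : HasDim (U +ₛ W) (ex + (ey + k))

  -- Extend a basis K of U ∩ W to bases X ++ K of U and Y ++ K of W; then X ++ Y ++ K is a basis of U + W.
  dimension-formula : ∀ {n} (U W : Subspace n) → DimensionFormula ⟦ U ⟧ ⟦ W ⟧
  dimension-formula (_ , VU) (_ , VW) = record
    { ex = X.size ; ey = Y.size ; k = K.size + 0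
    ; dimˡ = X.rows ++ Kb , X.independent , XK⊆U , X.spans
    ; dimʳ = Y.rows ++ Kb , Y.independent , YK⊆W , Y.spans
    ; dim∩ = Kb , K.independent , rowsp-least (∩-isSubspace SU SW) Kb K∩ , K.spans
    ; dim+ = B , independent-++-++ {X = X.rows} {Y.rows} {Kb} X.independent Y.independent
                   (λ v (xk , yk) → K.spans v (XK⊆U v xk , YK⊆W v yk))
               , B⊆U+W , U+W⊆B
    }
    where
      SU = rowsp-isSubspace VU
      SW = rowsp-isSubspace VW
      module K = Extension (extend-basis (λ v → rowsp? VU v ×-dec rowsp? VW v) [] independent-[])
      Kb = K.rows ++ []
      K∩ : All (rowsp VU ∩ₛ rowsp VW) Kb
      K∩ = All.++⁺ K.inside []
      module X = Extension (extend-basis (rowsp? VU) Kb K.independent)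
      module Y = Extension (extend-basis (rowsp? VW) Kb K.independent)
      B = X.rows ++ (Y.rows ++ Kb)

      XK⊆U : rowsp (X.rows ++ Kb) ⊆ₛ rowsp VU
      XK⊆U = rowsp-least SU _ (All.++⁺ X.inside (All.map proj₁ K∩))

      YK⊆W : rowsp (Y.rows ++ Kb) ⊆ₛ rowsp VW
      YK⊆W = rowsp-least SW _ (All.++⁺ Y.inside (All.map proj₂ K∩))

      B⊆U+W : rowsp B ⊆ₛ (rowsp VU +ₛ rowsp VW)
      B⊆U+W = rowsp-least (+-isSubspace SU SW) B (All.++⁺ (All.map (⊆-+ₛˡ SW _) X.inside)
                (All.++⁺ (All.map (⊆-+ₛʳ SU _) Y.inside) (All.map (⊆-+ₛˡ SW _ ∘ proj₁) K∩)))

      U+W⊆B : (rowsp VU +ₛ rowsp VW) ⊆ₛ rowsp B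
      U+W⊆B _ (u , w , u∈U , w∈W , refl) = IsSubspace.+-closed (rowsp-isSubspace B)
        (rowsp-++-insert X.rows Y.rows Kb u (X.spans u u∈U))
        (rowsp-++⁺ʳ X.rows (Y.rows ++ Kb) w (Y.spans w w∈W))

  distance : ∀ {n} {U W : Pred n} (D : DimensionFormula U W) →
             let open DimensionFormula D in DistIs U W (ex + ey)
  distance D = ex + (ey + k) , k , dim+ , dim∩ ,
               sym (trans (cong (_∸ k) (sym (ℕP.+-assoc ex ey k))) (ℕP.m+n∸n≡m (ex + ey) k))
    where open DimensionFormula D

  distance<-of-meeting : ∀ {n t v} (U W : Subspace n) → HasDim ⟦ U ⟧ t → HasDim ⟦ W ⟧ t →
    ⟦ U ⟧ v → ⟦ W ⟧ v → v ≢ zeroV → ∃[ d ] (DistIs ⟦ U ⟧ ⟦ W ⟧ d × d ℕ.< 2 * t)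
  distance<-of-meeting {n} {t} U W dimU dimW v∈U v∈W v≢0 =
    ex + ey , distance D , +-<-double (below ex dimˡ dimU) (below ey dimʳ dimW)
    where
      D = dimension-formula U W
      open DimensionFormula D
      0<k = dim-pos dim∩ (v∈U , v∈W) v≢0
      below : ∀ x {S : Pred n} → HasDim S (x + k) → HasDim S t → x ℕ.< t
      below x dim dim′ = subst (x ℕ.<_) (dim-unique dim dim′) (ℕP.m<m+n x 0<k)

  distance<-of-contained : ∀ {n s t} (U W Z : Subspace n) → HasDim ⟦ U ⟧ t → HasDim ⟦ W ⟧ t →
    ⟦ U ⟧ ⊆ₛ ⟦ Z ⟧ → ⟦ W ⟧ ⊆ₛ ⟦ Z ⟧ → HasDim ⟦ Z ⟧ s → s ℕ.< n →
    ∃[ d ] (DistIs ⟦ U ⟧ ⟦ W ⟧ d × d ℕ.< 2 * (n ∸ t))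
  distance<-of-contained {n} {t = t} U W Z dimU dimW U⊆Z W⊆Z dimZ s<n =
    ex + ey , distance D , +-<-double (below ex (ey + k) dimʳ dimW refl)
                                      (below ey (ex + k) dimˡ dimU (x∙yz≈y∙xz ey ex k))
    where
      D = dimension-formula U W
      open DimensionFormula D
      U+W⊆Z : (⟦ U ⟧ +ₛ ⟦ W ⟧) ⊆ₛ ⟦ Z ⟧
      U+W⊆Z _ (u , w , u∈U , w∈W , refl) =
        IsSubspace.+-closed (rowsp-isSubspace (proj₂ Z)) (U⊆Z u u∈U) (W⊆Z w w∈W)
      sum<n : ex + (ey + k) ℕ.< n
      sum<n = ℕP.≤-<-trans (dim-mono dim+ dimZ U+W⊆Z) s<n
      below : ∀ x y {S : Pred n} → HasDim S y → HasDim S t → x + y ≡ ex + (ey + k) → x ℕ.< n ∸ t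
      below x y dim dim′ e = ℕP.m+n≤o⇒m≤o∸n (suc x)
        (subst (λ z → suc (x + z) ℕ.≤ n) (dim-unique dim dim′) (subst (ℕ._< n) (sym e) sum<n))

module Orbits (F : Field) {q : ℕ} (order : HasOrder F q) where
  open LinAlg F
  open VectorAlgebra F
  open Subspaces F order
  open ≡-Reasoning

  ·ₛ-mono : ∀ {n} (U W : Subspace n) (A : Matrix n n) → ⟦ U ⟧ ⊆ₛ ⟦ W ⟧ → ⟦ U ·ₛ A ⟧ ⊆ₛ ⟦ W ·ₛ A ⟧
  ·ₛ-mono (_ , VU) (_ , VW) A U⊆W _ (c , refl) with U⊆W (c ⋆ VU) (c , refl)
  ... | d , e = d , (begin
    d ⋆ (VW ⊗ A)    ≡⟨ ⋆-⊗ d VW A ⟩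
    (d ⋆ VW) ⋆ A    ≡⟨ cong (_⋆ A) e ⟩
    (c ⋆ VU) ⋆ A    ≡⟨ sym (⋆-⊗ c VU A) ⟩
    c ⋆ (VU ⊗ A)    ∎)

  ·ₛ-identity : ∀ {n} (U : Subspace n) → ⟦ U ·ₛ identity ⟧ ≈ₛ ⟦ U ⟧
  ·ₛ-identity (_ , V) = (λ _ (c , e) → c , trans (sym (⋆-⊗-identity c)) e)
                      , (λ _ (c , e) → c , trans (⋆-⊗-identity c) e)
    where
      ⋆-⊗-identity : ∀ c → c ⋆ (V ⊗ identity) ≡ c ⋆ V
      ⋆-⊗-identity c = trans (⋆-⊗ c V identity) (⋆-identity _)

  module _ {n} {H : Matrix n n → Set} (grp : IsSubgroupGL n H) where

    orbit-self : (V : Subspace n) → Orb H V V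
    orbit-self V = identity , IsSubgroupGL.has-identity grp , swap (·ₛ-identity V)

    orbit-member : ∀ (V : Subspace n) {A} → H A → Orb H V (V ·ₛ A)
    orbit-member V {A} HA = A , HA , (λ _ p → p) , (λ _ p → p)

    stabilises-if-close : ∀ {m d} (V : Subspace n) {A} → H A → MinDistIs (Orb H V) m →
                          DistIs ⟦ V ⟧ ⟦ V ·ₛ A ⟧ d → d ℕ.< m → ⟦ V ·ₛ A ⟧ ≈ₛ ⟦ V ⟧
    stabilises-if-close V {A} HA (m≤distances , _) dist d<m with (V ·ₛ A) ≈? V
    ... | yes fixed = fixed
    ... | no moved = ⊥-elim (ℕP.<⇒≱ d<m
          (m≤distances V (V ·ₛ A) (orbit-self V) (orbit-member V HA) (moved ∘ swap) _ dist))

module FlagStabilisers (F : Field) {q : ℕ} (order : HasOrder F q)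
    {n r} {t : Fin r → ℕ} {𝓕 : Fin r → LinAlg.Subspace F n} (flag : LinAlg.IsFlag F t 𝓕)
    {H : LinAlg.Matrix F n n → Set} (grp : LinAlg.IsSubgroupGL F n H) where
  open LinAlg F
  open Subspaces F order
  open Dimension F order
  open Orbits F order
  open IsFlag flag

  flag-⊆ : ∀ {i j} → i Fin.≤ j → ⟦ 𝓕 i ⟧ ⊆ₛ ⟦ 𝓕 j ⟧
  flag-⊆ {i} {j} i≤j with ℕP.m≤n⇒m<n∨m≡n i≤j
  ... | inj₁ i<j = proj₁ (nested i j i<j)
  ... | inj₂ i≡j rewrite FinP.toℕ-injective i≡j = λ _ p → p

  stab-⊆-below : ∀ a → IsIndexA n t a → MaxDistCDC (Orb H (𝓕 a)) (t a) →
                 ∀ i → i Fin.≤ a → StabSubset H (𝓕 i) (𝓕 a)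
  stab-⊆-below a (2tₐ≤n , _) (orbit-dims , minDist , _) i i≤a A (HA , Ai≈i) =
    let v , v∈i , v≢0 = nonzero-∈ (type-pos i) (dims i)
        _ , dist , d<2tₐ = distance<-of-meeting (𝓕 a) (𝓕 a ·ₛ A)
          (dims a) (orbit-dims _ (orbit-member grp (𝓕 a) HA))
          (flag-⊆ i≤a v v∈i) (·ₛ-mono (𝓕 i) (𝓕 a) A (flag-⊆ i≤a) v (proj₂ Ai≈i v v∈i)) v≢0
    in HA , stabilises-if-close grp (𝓕 a) HA (minDist 2tₐ≤n) dist d<2tₐ

  stab-⊆-above : ∀ b → IsIndexB n t b → MaxDistCDC (Orb H (𝓕 b)) (t b) →
                 ∀ i → b Fin.≤ i → StabSubset H (𝓕 i) (𝓕 b)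
  stab-⊆-above b (n≤2t_b , _) (orbit-dims , _ , minDist) i b≤i A (HA , Ai≈i) =
    let _ , dist , d<2[n-t_b] = distance<-of-contained (𝓕 b) (𝓕 b ·ₛ A) (𝓕 i)
          (dims b) (orbit-dims _ (orbit-member grp (𝓕 b) HA))
          (flag-⊆ b≤i) bA⊆i (dims i) (type-lt-n i)
    in HA , stabilises-if-close grp (𝓕 b) HA (minDist n≤2t_b) dist d<2[n-t_b]
    where
      bA⊆i : ⟦ 𝓕 b ·ₛ A ⟧ ⊆ₛ ⟦ 𝓕 i ⟧
      bA⊆i v p = proj₁ Ai≈i v (·ₛ-mono (𝓕 b) (𝓕 i) A (flag-⊆ b≤i) v p)

proposition4p9 :
    (F : Field) (q : ℕ) → HasOrder F q →
    (n r : ℕ) (t : Fin r → ℕ) (𝓕 : Fin r → LinAlg.Subspace F n) →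
    LinAlg.IsFlag F t 𝓕 →
    (H : LinAlg.Matrix F n n → Set) → LinAlg.IsSubgroupGL F n H →
    (∀ a → LinAlg.IsIndexA F n t a → LinAlg.MaxDistCDC F (LinAlg.Orb F H (𝓕 a)) (t a)) →
    (∀ b → LinAlg.IsIndexB F n t b → LinAlg.MaxDistCDC F (LinAlg.Orb F H (𝓕 b)) (t b)) →
    (∀ a → LinAlg.IsIndexA F n t a → ∀ i → i ≤ a → LinAlg.StabSubset F H (𝓕 i) (𝓕 a))
    × (∀ b → LinAlg.IsIndexB F n t b → ∀ i → b ≤ i → LinAlg.StabSubset F H (𝓕 i) (𝓕 b))
proposition4p9 F q order n r t 𝓕 flag H grp maxDistA maxDistB =
  (λ a isA → stab-⊆-below a isA (maxDistA a isA)) , (λ b isB → stab-⊆-above b isB (maxDistB b isB))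
  where open FlagStabilisers F order flag grp
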